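{- Let $M$ be a finite set, $\mathcal L$ a nonempty family of subsets of $M$ which is a lattice under inclusion, with join $\lor$ and meet $\land$ (so $Z_1\lor Z_2\supseteq Z_1\cup Z_2$, $Z_1\land Z_2\subseteq Z_1\cap Z_2$), let $r:\mathcal L\to\mathbb R_{\ge0}$ and let $\mu$ be a measure on $M$. Assume that for $Z_1,Z_2\in\mathcal L$ with $Z_1\subsetneq Z_2$ we have $0\le r(Z_2)-r(Z_1)\le\mu(Z_2\setminus Z_1)$, and for incomparable $Z_1,Z_2\in\mathcal L$ we have $r(Z_1)+r(Z_2)\ge r(Z_1\land Z_2)+r(Z_1\lor Z_2)+\mu\big((Z_1\cap Z_2)\setminus(Z_1\land Z_2)\big)$. Let $r'(A)=\min\{r(Z)+\mu(A\setminus Z):Z\in\mathcal L\}$ for $A\subseteq M$. Then $(r',M)$ is a polymatroid, and $r'(A)=r(A)$ for every $A\in\mathcal L$.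
   Context: A (discrete) measure on a finite set is a non-negative additive set function. A polymatroid is a non-negative, monotone, submodular real function on subsets of a finite set. -}

module Defs where

open import Data.Nat using (ℕ)
open import Data.Product using (_×_; ∃; ∃-syntax; _,_)
open import Data.Fin.Subset using (Subset; _⊆_; _∪_; _∩_; _─_; ⊥)
open import Relation.Binary.PropositionalEquality using (_≡_)
open import Relation.Binary.Structures using (IsTotalOrder)
open import Algebra.Structures using (IsAbelianGroup)

-- The real
-- numbers ℝ (with +, 0, -, ≤) are an instance; the stdlib has no reals, so
-- the statement is made for an arbitrary such group.
record OrderedAbelianGroup : Set₁ where
  infixl 6 _+_ _-_
  infix 4 _≤_
  field
    Carrier        : Set
    _+_            : Carrier → Carrier → Carrier
    0#             : Carrier
    -_             : Carrier → Carrier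
    _≤_            : Carrier → Carrier → Set
    isAbelianGroup : IsAbelianGroup _≡_ _+_ 0# -_
    isTotalOrder   : IsTotalOrder _≡_ _≤_
    +-mono-≤       : ∀ {a b} c → a ≤ b → a + c ≤ b + c

  _-_ : Carrier → Carrier → Carrier
  a - b = a + (- b)

module _ (G : OrderedAbelianGroup) {n : ℕ} where
  open OrderedAbelianGroup G

  IsMeasure : (Subset n → Carrier) → Set
  IsMeasure μ =
    (∀ A → 0# ≤ μ A) ×
    (∀ A B → A ∩ B ≡ ⊥ → μ (A ∪ B) ≡ μ A + μ B)

  IsPolymatroid : (Subset n → Carrier) → Set
  IsPolymatroid f =
    (∀ A → 0# ≤ f A) ×
    (∀ A B → A ⊆ B → f A ≤ f B) ×
    (∀ A B → f (A ∪ B) + f (A ∩ B) ≤ f A + f B)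

  IsMinimumOver : (Subset n → Set) → (Subset n → Carrier) → Carrier → Set
  IsMinimumOver 𝓛 g m =
    (∃[ Z ] (𝓛 Z × m ≡ g Z)) × (∀ Z → 𝓛 Z → m ≤ g Z)

IsLatticeFamily : {n : ℕ} → (Subset n → Set) →
                  (Subset n → Subset n → Subset n) →
                  (Subset n → Subset n → Subset n) → Set
IsLatticeFamily {n} 𝓛 _∨_ _∧_ =
  (∃[ Z ] 𝓛 Z) ×
  (∀ Z₁ Z₂ → 𝓛 Z₁ → 𝓛 Z₂ →
     (𝓛 (Z₁ ∨ Z₂) × Z₁ ⊆ Z₁ ∨ Z₂ × Z₂ ⊆ Z₁ ∨ Z₂ ×
        (∀ W → 𝓛 W → Z₁ ⊆ W → Z₂ ⊆ W → Z₁ ∨ Z₂ ⊆ W)) ×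
     (𝓛 (Z₁ ∧ Z₂) × Z₁ ∧ Z₂ ⊆ Z₁ × Z₁ ∧ Z₂ ⊆ Z₂ ×
        (∀ W → 𝓛 W → W ⊆ Z₁ → W ⊆ Z₂ → W ⊆ Z₁ ∧ Z₂)))

{-# OPTIONS --safe #-}
module Submission where

-- Any Z₁, Z₂ ∈ 𝓛 can be
-- uncrossed: there are V ⊇ Z₁ ∪ Z₂ and W ⊆ Z₁ ∩ Z₂ in 𝓛 (Z₁ ∨ Z₂ and Z₁ ∧ Z₂, or Z₁
-- and Z₂ themselves when comparable) with r W + r V + μ ((Z₁ ∩ Z₂) ∖ W) ≤ r Z₁ + r Z₂.
-- Uncrossing the minimisers of A and B and using V, W as candidates for A ∪ B and
-- A ∩ B gives submodularity, because every point of M lies in at most as many of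
-- (A ∪ B) ∖ V, (A ∩ B) ∖ W as of (Z₁ ∩ Z₂) ∖ W, A ∖ Z₁, B ∖ Z₂.  For A ∈ 𝓛,
-- uncrossing A with any Z ∈ 𝓛 and the increment bounds r A ≤ r V,
-- r A ≤ r W + μ (A ∖ W) give 2 r A ≤ r A + r Z + μ (A ∖ Z), hence r′ A = r A.

open import Defs
open import Data.Nat using (ℕ)
open import Data.Product using (_×_)
open import Data.Fin.Subset using (Subset; _⊆_; _⊈_; _⊂_; _∩_; _─_)
open import Relation.Binary.PropositionalEquality using (_≡_)

open import Algebra.Bundles using (AbelianGroup)
import Algebra.Properties.CommutativeSemigroup as CommutativeSemigroupProperties
import Algebra.Properties.Group as GroupProperties
open import Data.Fin using (Fin)
open import Data.Fin.Subset using (_∪_; ⊥; _∈_; _∉_; outside)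
open import Data.Fin.Subset.Properties
  using (_∈?_; _⊆?_; _⊂?_; ⊆-antisym; Empty-unique; p∩q⊆p; p∩q⊆q; p⊆p∪q; q⊆p∪q; ∩-idem; ∪-idem;
         x∈p∩q⁺; x∈p∩q⁻; x∈p∪q⁺; x∈p∪q⁻; x∈p∧x∉q⇒x∈p─q; p─q⊆p; drop-there)
open import Data.Product using (_,_; proj₁; proj₂)
open import Data.Sum as Sum using (_⊎_; inj₁; inj₂; [_,_]′)
open import Data.Vec using (_∷_; here; there)
open import Function using (_∘_; id)
open import Relation.Binary.Bundles using (TotalOrder)
import Relation.Binary.Reasoning.PartialOrder as PartialOrderReasoning
open import Relation.Binary.PropositionalEquality
  using (refl; sym; trans; cong; cong₂; subst; subst₂; module ≡-Reasoning)
open import Relation.Nullary using (yes; no; contradiction)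

private variable
  n : ℕ
  x : Fin n
  p q s : Subset n

x∈p─q⇒x∉q : ∀ (p q : Subset n) → x ∈ p ─ q → x ∉ q
x∈p─q⇒x∉q (_ ∷ p) (outside ∷ q) here           = λ ()
x∈p─q⇒x∉q (_ ∷ p) (_       ∷ q) (there x∈p─q) = x∈p─q⇒x∉q p q x∈p─q ∘ drop-there

x∈p─q⁻ : ∀ (p q : Subset n) → x ∈ p ─ q → x ∈ p × x ∉ q
x∈p─q⁻ p q x∈p─q = p─q⊆p p q x∈p─q , x∈p─q⇒x∉q p q x∈p─q

x∈q⇒x∈p⊎x∈q─p : ∀ (p : Subset n) → x ∈ q → x ∈ p ⊎ x ∈ q ─ p
x∈q⇒x∈p⊎x∈q─p {x = x} p x∈q with x ∈? p
... | yes x∈p = inj₁ x∈p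
... | no  x∉p = inj₂ (x∈p∧x∉q⇒x∈p─q x∈q x∉p)

─-monoˡ : p ⊆ q → p ─ s ⊆ q ─ s
─-monoˡ {p = p} {s = s} p⊆q x∈p─s =
  let x∈p , x∉s = x∈p─q⁻ p s x∈p─s in x∈p∧x∉q⇒x∈p─q (p⊆q x∈p) x∉s

p⊆q⇒p─q≡⊥ : p ⊆ q → p ─ q ≡ ⊥
p⊆q⇒p─q≡⊥ {p = p} {q = q} p⊆q = Empty-unique λ (_ , x∈p─q) →
  let x∈p , x∉q = x∈p─q⁻ p q x∈p─q in x∉q (p⊆q x∈p)

p∩[q─p]≡⊥ : ∀ (p q : Subset n) → p ∩ (q ─ p) ≡ ⊥
p∩[q─p]≡⊥ p q = Empty-unique λ (_ , x∈p∩[q─p]) →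
  let x∈p , x∈q─p = x∈p∩q⁻ p (q ─ p) x∈p∩[q─p] in x∈p─q⇒x∉q q p x∈q─p x∈p

p⊆q⇒p∪[q─p]≡q : p ⊆ q → p ∪ (q ─ p) ≡ q
p⊆q⇒p∪[q─p]≡q {p = p} {q = q} p⊆q =
  ⊆-antisym ([ p⊆q , p─q⊆p q p ]′ ∘ x∈p∪q⁻ p (q ─ p)) (x∈p∪q⁺ ∘ x∈q⇒x∈p⊎x∈q─p p)

[p∪q]─p≡q─[p∩q] : ∀ (p q : Subset n) → (p ∪ q) ─ p ≡ q ─ (p ∩ q)
[p∪q]─p≡q─[p∩q] p q = ⊆-antisym forward backward
  where
  forward : (p ∪ q) ─ p ⊆ q ─ (p ∩ q)
  forward x∈[p∪q]─p =
    let x∈p∪q , x∉p = x∈p─q⁻ (p ∪ q) p x∈[p∪q]─p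
        x∈q = [ (λ x∈p → contradiction x∈p x∉p) , id ]′ (x∈p∪q⁻ p q x∈p∪q)
    in x∈p∧x∉q⇒x∈p─q x∈q (x∉p ∘ proj₁ ∘ x∈p∩q⁻ p q)
  backward : q ─ (p ∩ q) ⊆ (p ∪ q) ─ p
  backward x∈q─[p∩q] =
    let x∈q , x∉p∩q = x∈p─q⁻ q (p ∩ q) x∈q─[p∩q]
    in x∈p∧x∉q⇒x∈p─q (q⊆p∪q p q x∈q) (λ x∈p → x∉p∩q (x∈p∩q⁺ (x∈p , x∈q)))

p⊆q⇒p⊂q⊎p≡q : p ⊆ q → p ⊂ q ⊎ p ≡ q
p⊆q⇒p⊂q⊎p≡q {p = p} {q = q} p⊆q with p ⊂? q
... | yes p⊂q = inj₁ p⊂q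
... | no  p⊄q = inj₂ (⊆-antisym p⊆q q⊆p)
  where
  q⊆p : q ⊆ p
  q⊆p x∈q with x∈q⇒x∈p⊎x∈q─p p x∈q
  ... | inj₁ x∈p   = x∈p
  ... | inj₂ x∈q─p = contradiction ((λ {_} → p⊆q) , _ , x∈q , x∈p─q⇒x∉q q p x∈q─p) p⊄q

[p∪q]─s⊆[p─z₁]∪[q─z₂] : ∀ (p q : Subset n) {s z₁ z₂} → z₁ ⊆ s → z₂ ⊆ s →
                         (p ∪ q) ─ s ⊆ (p ─ z₁) ∪ (q ─ z₂)
[p∪q]─s⊆[p─z₁]∪[q─z₂] p q {s} z₁⊆s z₂⊆s x∈[p∪q]─s =
  let x∈p∪q , x∉s = x∈p─q⁻ (p ∪ q) s x∈[p∪q]─s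
  in x∈p∪q⁺ (Sum.map (λ x∈p → x∈p∧x∉q⇒x∈p─q x∈p (x∉s ∘ z₁⊆s))
                     (λ x∈q → x∈p∧x∉q⇒x∈p─q x∈q (x∉s ∘ z₂⊆s))
                     (x∈p∪q⁻ p q x∈p∪q))

[p∩q]─s⊆[z₁∩z₂]─s∪[p─z₁]∪[q─z₂] : ∀ (p q : Subset n) {s} z₁ z₂ →
  (p ∩ q) ─ s ⊆ ((z₁ ∩ z₂) ─ s) ∪ ((p ─ z₁) ∪ (q ─ z₂))
[p∩q]─s⊆[z₁∩z₂]─s∪[p─z₁]∪[q─z₂] p q {s} z₁ z₂ x∈[p∩q]─s
  with x∈p─q⁻ (p ∩ q) s x∈[p∩q]─s
... | x∈p∩q , x∉s with x∈p∩q⁻ p q x∈p∩q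
...   | x∈p , x∈q with x∈q⇒x∈p⊎x∈q─p z₁ x∈p | x∈q⇒x∈p⊎x∈q─p z₂ x∈q
...     | inj₁ x∈z₁ | inj₁ x∈z₂   = x∈p∪q⁺ (inj₁ (x∈p∧x∉q⇒x∈p─q (x∈p∩q⁺ (x∈z₁ , x∈z₂)) x∉s))
...     | inj₁ _    | inj₂ x∈q─z₂ = x∈p∪q⁺ (inj₂ (x∈p∪q⁺ (inj₂ x∈q─z₂)))
...     | inj₂ x∈p─z₁ | _         = x∈p∪q⁺ (inj₂ (x∈p∪q⁺ (inj₁ x∈p─z₁)))

[p∪q]─s∩[p∩q]─t⊆[p─z₁]∩[q─z₂] : ∀ (p q : Subset n) {s t z₁ z₂} → z₁ ⊆ s → z₂ ⊆ s →
                                 ((p ∪ q) ─ s) ∩ ((p ∩ q) ─ t) ⊆ (p ─ z₁) ∩ (q ─ z₂)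
[p∪q]─s∩[p∩q]─t⊆[p─z₁]∩[q─z₂] p q {s} {t} z₁⊆s z₂⊆s x∈ =
  let x∈[p∪q]─s , x∈[p∩q]─t = x∈p∩q⁻ ((p ∪ q) ─ s) ((p ∩ q) ─ t) x∈
      x∉s = x∈p─q⇒x∉q (p ∪ q) s x∈[p∪q]─s
      x∈p , x∈q = x∈p∩q⁻ p q (p─q⊆p (p ∩ q) t x∈[p∩q]─t)
  in x∈p∩q⁺ (x∈p∧x∉q⇒x∈p─q x∈p (x∉s ∘ z₁⊆s) , x∈p∧x∉q⇒x∈p─q x∈q (x∉s ∘ z₂⊆s))

p─s⊆[p∩z]─s∪[p─z] : ∀ (p : Subset n) {s} z → p ─ s ⊆ ((p ∩ z) ─ s) ∪ (p ─ z)
p─s⊆[p∩z]─s∪[p─z] p {s} z x∈p─s =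
  let x∈p , x∉s = x∈p─q⁻ p s x∈p─s
  in x∈p∪q⁺ (Sum.map₁ (λ x∈z → x∈p∧x∉q⇒x∈p─q (x∈p∩q⁺ (x∈p , x∈z)) x∉s) (x∈q⇒x∈p⊎x∈q─p z x∈p))

module OrderedAbelianGroupProperties (G : OrderedAbelianGroup) where

  open OrderedAbelianGroup G public renaming (+-mono-≤ to +-monoˡ-≤)

  abelianGroup : AbelianGroup _ _
  abelianGroup = record { isAbelianGroup = isAbelianGroup }

  totalOrder : TotalOrder _ _ _
  totalOrder = record { isTotalOrder = isTotalOrder }

  open AbelianGroup abelianGroup public using (assoc; comm; identityˡ; identityʳ)
  open AbelianGroup abelianGroup using (group; commutativeSemigroup)
  open TotalOrder totalOrder using (poset)
  open TotalOrder totalOrder public using ()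
    renaming (refl to ≤-refl; reflexive to ≤-reflexive; trans to ≤-trans; antisym to ≤-antisym)
  open GroupProperties group public using (identityʳ-unique; //-rightDividesˡ; //-rightDividesʳ)
  open CommutativeSemigroupProperties commutativeSemigroup public using (interchange; xy∙z≈xz∙y)

  module ≤-Reasoning = PartialOrderReasoning poset

  +-monoʳ-≤ : ∀ c {a b} → a ≤ b → c + a ≤ c + b
  +-monoʳ-≤ c {a} {b} a≤b = subst₂ _≤_ (comm a c) (comm b c) (+-monoˡ-≤ c a≤b)

  +-mono-≤ : ∀ {a b c d} → a ≤ b → c ≤ d → a + c ≤ b + d
  +-mono-≤ {b = b} {c = c} a≤b c≤d = ≤-trans (+-monoˡ-≤ c a≤b) (+-monoʳ-≤ b c≤d)

  +-nonneg : ∀ {a b} → 0# ≤ a → 0# ≤ b → 0# ≤ a + b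
  +-nonneg {a} {b} 0≤a 0≤b = subst (_≤ a + b) (identityʳ 0#) (+-mono-≤ 0≤a 0≤b)

  x≤x+y : ∀ {a b} → 0# ≤ b → a ≤ a + b
  x≤x+y {a} {b} 0≤b = subst (_≤ a + b) (identityʳ a) (+-monoʳ-≤ a 0≤b)

  +-cancelʳ-≤ : ∀ c {a b} → a + c ≤ b + c → a ≤ b
  +-cancelʳ-≤ c {a} {b} a+c≤b+c =
    subst₂ _≤_ (//-rightDividesʳ c a) (//-rightDividesʳ c b) (+-monoˡ-≤ (- c) a+c≤b+c)

  +-cancelˡ-≤ : ∀ c {a b} → c + a ≤ c + b → a ≤ b
  +-cancelˡ-≤ c {a} {b} c+a≤c+b = +-cancelʳ-≤ c (subst₂ _≤_ (comm c a) (comm c b) c+a≤c+b)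

  0≤x-y⇒y≤x : ∀ {a b} → 0# ≤ a - b → b ≤ a
  0≤x-y⇒y≤x {a} {b} 0≤a-b = subst₂ _≤_ (identityˡ b) (//-rightDividesˡ b a) (+-monoˡ-≤ b 0≤a-b)

  x-y≤z⇒x≤y+z : ∀ {a b c} → a - b ≤ c → a ≤ b + c
  x-y≤z⇒x≤y+z {a} {b} {c} a-b≤c = subst₂ _≤_ (//-rightDividesˡ b a) (comm c b) (+-monoˡ-≤ b a-b≤c)

module MeasureProperties (G : OrderedAbelianGroup) {μ : Subset n → OrderedAbelianGroup.Carrier G}
                         (isMeasure : IsMeasure G μ) where

  open OrderedAbelianGroupProperties G

  μ-nonneg : ∀ p → 0# ≤ μ p
  μ-nonneg = proj₁ isMeasure

  μ-disjoint : ∀ p q → p ∩ q ≡ ⊥ → μ (p ∪ q) ≡ μ p + μ q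
  μ-disjoint = proj₂ isMeasure

  μ-⊥≡0 : μ ⊥ ≡ 0#
  μ-⊥≡0 = identityʳ-unique (μ ⊥) (μ ⊥)
    (trans (sym (μ-disjoint ⊥ ⊥ (∩-idem ⊥))) (cong μ (∪-idem ⊥)))

  p⊆q⇒μ[p─q]≡0 : p ⊆ q → μ (p ─ q) ≡ 0#
  p⊆q⇒μ[p─q]≡0 p⊆q = trans (cong μ (p⊆q⇒p─q≡⊥ p⊆q)) μ-⊥≡0

  μ-split : p ⊆ q → μ q ≡ μ p + μ (q ─ p)
  μ-split {p = p} {q = q} p⊆q = begin
    μ q                ≡⟨ cong μ (p⊆q⇒p∪[q─p]≡q p⊆q) ⟨
    μ (p ∪ (q ─ p))    ≡⟨ μ-disjoint p (q ─ p) (p∩[q─p]≡⊥ p q) ⟩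
    μ p + μ (q ─ p)    ∎
    where open ≡-Reasoning

  μ-mono : p ⊆ q → μ p ≤ μ q
  μ-mono {p = p} {q = q} p⊆q = subst (μ p ≤_) (sym (μ-split p⊆q)) (x≤x+y (μ-nonneg (q ─ p)))

  μ-modular : ∀ p q → μ (p ∪ q) + μ (p ∩ q) ≡ μ p + μ q
  μ-modular p q = begin
    μ (p ∪ q) + μ (p ∩ q)                ≡⟨ cong (_+ μ (p ∩ q)) (μ-split (p⊆p∪q q)) ⟩
    μ p + μ ((p ∪ q) ─ p) + μ (p ∩ q)    ≡⟨ cong (λ d → μ p + μ d + μ (p ∩ q)) ([p∪q]─p≡q─[p∩q] p q) ⟩
    μ p + μ (q ─ (p ∩ q)) + μ (p ∩ q)    ≡⟨ assoc (μ p) _ _ ⟩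
    μ p + (μ (q ─ (p ∩ q)) + μ (p ∩ q))  ≡⟨ cong (μ p +_) (comm _ _) ⟩
    μ p + (μ (p ∩ q) + μ (q ─ (p ∩ q)))  ≡⟨ cong (μ p +_) (μ-split (p∩q⊆q p q)) ⟨
    μ p + μ q                            ∎
    where open ≡-Reasoning

  μ-subadditive : p ⊆ q ∪ s → μ p ≤ μ q + μ s
  μ-subadditive {p = p} {q = q} {s = s} p⊆q∪s = begin
    μ p                    ≤⟨ μ-mono p⊆q∪s ⟩
    μ (q ∪ s)              ≤⟨ x≤x+y (μ-nonneg (q ∩ s)) ⟩
    μ (q ∪ s) + μ (q ∩ s)  ≡⟨ μ-modular q s ⟩
    μ q + μ s              ∎
    where open ≤-Reasoning

  μ-+-≤-cover : ∀ {p q a b c} → p ∪ q ⊆ a ∪ (b ∪ c) → p ∩ q ⊆ b ∩ c →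
                μ p + μ q ≤ μ a + (μ b + μ c)
  μ-+-≤-cover {p} {q} {a} {b} {c} p∪q⊆a∪[b∪c] p∩q⊆b∩c = begin
    μ p + μ q                          ≡⟨ μ-modular p q ⟨
    μ (p ∪ q) + μ (p ∩ q)              ≤⟨ +-mono-≤ (μ-subadditive p∪q⊆a∪[b∪c]) (μ-mono p∩q⊆b∩c) ⟩
    μ a + μ (b ∪ c) + μ (b ∩ c)        ≡⟨ assoc (μ a) _ _ ⟩
    μ a + (μ (b ∪ c) + μ (b ∩ c))      ≡⟨ cong (μ a +_) (μ-modular b c) ⟩
    μ a + (μ b + μ c)                  ∎
    where open ≤-Reasoning

module InducedRank (G : OrderedAbelianGroup) {n : ℕ} (𝓛 : Subset n → Set)
                   (_∨_ _∧_ : Subset n → Subset n → Subset n)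
                   (r μ : Subset n → OrderedAbelianGroup.Carrier G)
                   (isMeasure : IsMeasure G μ) where

  open OrderedAbelianGroupProperties G
  open MeasureProperties G isMeasure

  IncrementsBoundedByμ : Set
  IncrementsBoundedByμ = ∀ Z₁ Z₂ → 𝓛 Z₁ → 𝓛 Z₂ → Z₁ ⊂ Z₂ →
                         (0# ≤ r Z₂ - r Z₁) × (r Z₂ - r Z₁ ≤ μ (Z₂ ─ Z₁))

  CrossingInequality : Set
  CrossingInequality = ∀ Z₁ Z₂ → 𝓛 Z₁ → 𝓛 Z₂ → Z₁ ⊈ Z₂ → Z₂ ⊈ Z₁ →
                       r (Z₁ ∧ Z₂) + r (Z₁ ∨ Z₂) + μ ((Z₁ ∩ Z₂) ─ (Z₁ ∧ Z₂)) ≤ r Z₁ + r Z₂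

  cost : Subset n → Subset n → Carrier
  cost A Z = r Z + μ (A ─ Z)

  IsInducedRank : (Subset n → Carrier) → Set
  IsInducedRank r′ = ∀ A → IsMinimumOver G 𝓛 (cost A) (r′ A)

  module _ (increments : IncrementsBoundedByμ) {X Y : Subset n}
           (X∈𝓛 : 𝓛 X) (Y∈𝓛 : 𝓛 Y) (X⊆Y : X ⊆ Y) where

    r-mono : r X ≤ r Y
    r-mono with p⊆q⇒p⊂q⊎p≡q X⊆Y
    ... | inj₁ X⊂Y = 0≤x-y⇒y≤x (proj₁ (increments X Y X∈𝓛 Y∈𝓛 X⊂Y))
    ... | inj₂ refl = ≤-refl

    r≤r+μ─ : r Y ≤ r X + μ (Y ─ X)
    r≤r+μ─ with p⊆q⇒p⊂q⊎p≡q X⊆Y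
    ... | inj₁ X⊂Y = x-y≤z⇒x≤y+z (proj₂ (increments X Y X∈𝓛 Y∈𝓛 X⊂Y))
    ... | inj₂ refl = x≤x+y (μ-nonneg (X ─ X))

  record Uncrossing (Z₁ Z₂ : Subset n) : Set where
    field
      upper lower   : Subset n
      upper∈𝓛      : 𝓛 upper
      lower∈𝓛      : 𝓛 lower
      Z₁⊆upper      : Z₁ ⊆ upper
      Z₂⊆upper      : Z₂ ⊆ upper
      lower⊆Z₁      : lower ⊆ Z₁
      lower⊆Z₂      : lower ⊆ Z₂
      uncross       : r lower + r upper + μ ((Z₁ ∩ Z₂) ─ lower) ≤ r Z₁ + r Z₂

  uncrossing : IsLatticeFamily 𝓛 _∨_ _∧_ → CrossingInequality →
               ∀ {Z₁ Z₂} → 𝓛 Z₁ → 𝓛 Z₂ → Uncrossing Z₁ Z₂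
  uncrossing (_ , lattice) crossing {Z₁} {Z₂} Z₁∈𝓛 Z₂∈𝓛 with Z₁ ⊆? Z₂ | Z₂ ⊆? Z₁
  ... | yes Z₁⊆Z₂ | _ = record
    { upper = Z₂ ; lower = Z₁ ; upper∈𝓛 = Z₂∈𝓛 ; lower∈𝓛 = Z₁∈𝓛
    ; Z₁⊆upper = Z₁⊆Z₂ ; Z₂⊆upper = id ; lower⊆Z₁ = id ; lower⊆Z₂ = Z₁⊆Z₂
    ; uncross = ≤-reflexive (trans (cong (r Z₁ + r Z₂ +_) (p⊆q⇒μ[p─q]≡0 (p∩q⊆p Z₁ Z₂)))
                                   (identityʳ (r Z₁ + r Z₂)))
    }
  ... | no _ | yes Z₂⊆Z₁ = record
    { upper = Z₁ ; lower = Z₂ ; upper∈𝓛 = Z₁∈𝓛 ; lower∈𝓛 = Z₂∈𝓛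
    ; Z₁⊆upper = id ; Z₂⊆upper = Z₂⊆Z₁ ; lower⊆Z₁ = Z₂⊆Z₁ ; lower⊆Z₂ = id
    ; uncross = ≤-reflexive (trans (cong (r Z₂ + r Z₁ +_) (p⊆q⇒μ[p─q]≡0 (p∩q⊆q Z₁ Z₂)))
                                   (trans (identityʳ (r Z₂ + r Z₁)) (comm (r Z₂) (r Z₁))))
    }
  ... | no Z₁⊈Z₂ | no Z₂⊈Z₁ with lattice Z₁ Z₂ Z₁∈𝓛 Z₂∈𝓛
  ...   | (∨∈𝓛 , Z₁⊆∨ , Z₂⊆∨ , _) , (∧∈𝓛 , ∧⊆Z₁ , ∧⊆Z₂ , _) = record
    { upper = Z₁ ∨ Z₂ ; lower = Z₁ ∧ Z₂ ; upper∈𝓛 = ∨∈𝓛 ; lower∈𝓛 = ∧∈𝓛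
    ; Z₁⊆upper = Z₁⊆∨ ; Z₂⊆upper = Z₂⊆∨ ; lower⊆Z₁ = ∧⊆Z₁ ; lower⊆Z₂ = ∧⊆Z₂
    ; uncross = crossing Z₁ Z₂ Z₁∈𝓛 Z₂∈𝓛 Z₁⊈Z₂ Z₂⊈Z₁
    }

  module _ {r′ : Subset n → Carrier} (isInducedRank : IsInducedRank r′) where

    r′≤cost : ∀ A {Z} → 𝓛 Z → r′ A ≤ cost A Z
    r′≤cost A {Z} = proj₂ (isInducedRank A) Z

    r′-nonneg : (∀ Z → 𝓛 Z → 0# ≤ r Z) → ∀ A → 0# ≤ r′ A
    r′-nonneg r-nonneg A with proj₁ (isInducedRank A)
    ... | Z , Z∈𝓛 , r′A≡cost =
      subst (0# ≤_) (sym r′A≡cost) (+-nonneg (r-nonneg Z Z∈𝓛) (μ-nonneg (A ─ Z)))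

    r′-mono : ∀ A B → A ⊆ B → r′ A ≤ r′ B
    r′-mono A B A⊆B with proj₁ (isInducedRank B)
    ... | Z , Z∈𝓛 , r′B≡cost = begin
      r′ A             ≤⟨ r′≤cost A Z∈𝓛 ⟩
      r Z + μ (A ─ Z)  ≤⟨ +-monoʳ-≤ (r Z) (μ-mono (─-monoˡ A⊆B)) ⟩
      r Z + μ (B ─ Z)  ≡⟨ r′B≡cost ⟨
      r′ B             ∎
      where open ≤-Reasoning

    r′-submodular : IsLatticeFamily 𝓛 _∨_ _∧_ → CrossingInequality →
                    ∀ A B → r′ (A ∪ B) + r′ (A ∩ B) ≤ r′ A + r′ B
    r′-submodular lattice crossing A B with proj₁ (isInducedRank A) | proj₁ (isInducedRank B)
    ... | Z₁ , Z₁∈𝓛 , r′A≡cost | Z₂ , Z₂∈𝓛 , r′B≡cost = begin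
      r′ (A ∪ B) + r′ (A ∩ B)
        ≤⟨ +-mono-≤ (r′≤cost (A ∪ B) upper∈𝓛) (r′≤cost (A ∩ B) lower∈𝓛) ⟩
      (r upper + μ X) + (r lower + μ Y)
        ≡⟨ interchange (r upper) (μ X) (r lower) (μ Y) ⟩
      (r upper + r lower) + (μ X + μ Y)
        ≤⟨ +-monoʳ-≤ (r upper + r lower) (μ-+-≤-cover X∪Y-cover X∩Y-cover) ⟩
      (r upper + r lower) + (μ P + (μ Q + μ R))
        ≡⟨ cong (_+ (μ P + (μ Q + μ R))) (comm (r upper) (r lower)) ⟩
      (r lower + r upper) + (μ P + (μ Q + μ R))
        ≡⟨ assoc (r lower + r upper) (μ P) (μ Q + μ R) ⟨
      (r lower + r upper + μ P) + (μ Q + μ R)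
        ≤⟨ +-monoˡ-≤ (μ Q + μ R) uncross ⟩
      (r Z₁ + r Z₂) + (μ Q + μ R)
        ≡⟨ interchange (r Z₁) (r Z₂) (μ Q) (μ R) ⟩
      (r Z₁ + μ Q) + (r Z₂ + μ R)
        ≡⟨ cong₂ _+_ r′A≡cost r′B≡cost ⟨
      r′ A + r′ B ∎
      where
      open ≤-Reasoning
      open Uncrossing (uncrossing lattice crossing Z₁∈𝓛 Z₂∈𝓛)
      X Y P Q R : Subset n
      X = (A ∪ B) ─ upper
      Y = (A ∩ B) ─ lower
      P = (Z₁ ∩ Z₂) ─ lower
      Q = A ─ Z₁
      R = B ─ Z₂
      X∪Y-cover : X ∪ Y ⊆ P ∪ (Q ∪ R)
      X∪Y-cover x∈X∪Y = [ q⊆p∪q P (Q ∪ R) ∘ [p∪q]─s⊆[p─z₁]∪[q─z₂] A B Z₁⊆upper Z₂⊆upper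
                         , [p∩q]─s⊆[z₁∩z₂]─s∪[p─z₁]∪[q─z₂] A B Z₁ Z₂
                         ]′ (x∈p∪q⁻ X Y x∈X∪Y)
      X∩Y-cover : X ∩ Y ⊆ Q ∩ R
      X∩Y-cover = [p∪q]─s∩[p∩q]─t⊆[p─z₁]∩[q─z₂] A B Z₁⊆upper Z₂⊆upper

    r≤cost : IncrementsBoundedByμ → IsLatticeFamily 𝓛 _∨_ _∧_ → CrossingInequality →
             ∀ {A Z} → 𝓛 A → 𝓛 Z → r A ≤ cost A Z
    r≤cost increments lattice crossing {A} {Z} A∈𝓛 Z∈𝓛 = +-cancelˡ-≤ (r A) (begin
      r A + r A
        ≤⟨ +-mono-≤ (r≤r+μ─ increments lower∈𝓛 A∈𝓛 lower⊆Z₁)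
                    (r-mono increments A∈𝓛 upper∈𝓛 Z₁⊆upper) ⟩
      r lower + μ (A ─ lower) + r upper
        ≡⟨ xy∙z≈xz∙y (r lower) (μ (A ─ lower)) (r upper) ⟩
      r lower + r upper + μ (A ─ lower)
        ≤⟨ +-monoʳ-≤ (r lower + r upper) (μ-subadditive (p─s⊆[p∩z]─s∪[p─z] A Z)) ⟩
      r lower + r upper + (μ ((A ∩ Z) ─ lower) + μ (A ─ Z))
        ≡⟨ assoc (r lower + r upper) _ _ ⟨
      r lower + r upper + μ ((A ∩ Z) ─ lower) + μ (A ─ Z)
        ≤⟨ +-monoˡ-≤ (μ (A ─ Z)) uncross ⟩
      r A + r Z + μ (A ─ Z)
        ≡⟨ assoc (r A) (r Z) (μ (A ─ Z)) ⟩
      r A + (r Z + μ (A ─ Z)) ∎)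
      where
      open ≤-Reasoning
      open Uncrossing (uncrossing lattice crossing A∈𝓛 Z∈𝓛)

    r′≡r : IncrementsBoundedByμ → IsLatticeFamily 𝓛 _∨_ _∧_ → CrossingInequality →
           ∀ A → 𝓛 A → r′ A ≡ r A
    r′≡r increments lattice crossing A A∈𝓛 with proj₁ (isInducedRank A)
    ... | Z , Z∈𝓛 , r′A≡cost = ≤-antisym r′A≤rA rA≤r′A
      where
      r′A≤rA : r′ A ≤ r A
      r′A≤rA = ≤-trans (r′≤cost A A∈𝓛)
        (≤-reflexive (trans (cong (r A +_) (p⊆q⇒μ[p─q]≡0 id)) (identityʳ (r A))))
      rA≤r′A : r A ≤ r′ A
      rA≤r′A = subst (r A ≤_) (sym r′A≡cost) (r≤cost increments lattice crossing A∈𝓛 Z∈𝓛)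

lemma3 : (G : OrderedAbelianGroup) → let open OrderedAbelianGroup G in
    (n : ℕ) (𝓛 : Subset n → Set)
    (_∨_ _∧_ : Subset n → Subset n → Subset n)
    (r μ : Subset n → Carrier) →
    IsLatticeFamily 𝓛 _∨_ _∧_ →
    (∀ Z → 𝓛 Z → 0# ≤ r Z) →
    IsMeasure G μ →
    (∀ Z₁ Z₂ → 𝓛 Z₁ → 𝓛 Z₂ → Z₁ ⊂ Z₂ →
       (0# ≤ r Z₂ - r Z₁) × (r Z₂ - r Z₁ ≤ μ (Z₂ ─ Z₁))) →
    (∀ Z₁ Z₂ → 𝓛 Z₁ → 𝓛 Z₂ → Z₁ ⊈ Z₂ → Z₂ ⊈ Z₁ →
       r (Z₁ ∧ Z₂) + r (Z₁ ∨ Z₂) + μ ((Z₁ ∩ Z₂) ─ (Z₁ ∧ Z₂)) ≤ r Z₁ + r Z₂) →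
    (r′ : Subset n → Carrier) →
    (∀ A → IsMinimumOver G 𝓛 (λ Z → r Z + μ (A ─ Z)) (r′ A)) →
    IsPolymatroid G r′ × (∀ A → 𝓛 A → r′ A ≡ r A)
lemma3 G n 𝓛 _∨_ _∧_ r μ lattice r-nonneg isMeasure increments crossing r′ isInducedRank =
  ( r′-nonneg isInducedRank r-nonneg
  , r′-mono isInducedRank
  , r′-submodular isInducedRank lattice crossing )
  , r′≡r isInducedRank increments lattice crossing
  where open InducedRank G 𝓛 _∨_ _∧_ r μ isMeasure
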